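{- Let $n,k,w$ be integers with $k < w < kn$. Let $\alpha_1=\mathtt{a}_1\mathtt{a}_2\cdots\mathtt{a}_n$ be the lexicographically smallest necklace in $\mathbf{N}_k(n,w^\uparrow)$. Let $\mathbf{s}\in\mathbf{S}_k(n,w^\uparrow)$ be a string that is not of the form $\mathtt{k}^{n-j}\mathtt{a}_1\cdots\mathtt{a}_j$ for any $0\le j<n$. Write $\mathbf{s}=\mathbf{p}\mathbf{q}$ where $\mathbf{q}$ is the longest suffix of $\mathbf{s}$ such that $\mathbf{q}\mathbf{p}$ is a necklace. Let $\beta_1,\beta_2$ be the unique consecutive necklaces in the lexicographically ordered list $\mathbf{N}_k(n)$ (considered cyclically) such that $\mathbf{p}$ is a suffix of $\beta_1$ and $\mathbf{q}$ is a prefix of $\beta_2$. Let $\delta_1$ be the largest necklace in $\mathbf{N}_k(n,w^\uparrow)$ that is lexicographically smaller than or equal to $\beta_1$. Then $\mathrm{ap}(\delta_1)$ has suffix $\mathbf{p}$.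
   Context: $\mathbf{S}_k(n)$ is the set of length-$n$ strings over the alphabet $\{\mathtt{1},\mathtt{2},\ldots,\mathtt{k}\}$ (symbols ordered as integers); the weight of a string is the sum of its symbols; $\mathbf{S}_k(n,w^\uparrow)$ is the set of strings in $\mathbf{S}_k(n)$ of weight at least $w$. A necklace is a string that is lexicographically smallest among all its rotations. $\mathbf{N}_k(n)$ is the list of all necklaces in $\mathbf{S}_k(n)$ in lexicographic order, and $\mathbf{N}_k(n,w^\uparrow)$ is the list of necklaces in $\mathbf{S}_k(n,w^\uparrow)$ in lexicographic order. For a string $\mathbf{s}$, $\mathrm{ap}(\mathbf{s})$ (the aperiodic prefix) is the shortest string $\mathbf{t}$ with $\mathbf{s}=\mathbf{t}^j$ for some $j\ge1$. $\mathtt{k}^{m}$ denotes the symbol $\mathtt{k}$ repeated $m$ times. It is a known fact that $\beta_1,\beta_2$ as in the claim exist and are unique. -}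

module Defs where

open import Data.Nat using (ℕ; zero; suc; _+_; _*_; _∸_; _≤_; _<_)
open import Data.List using (List; []; _∷_; _++_; length; drop; take; replicate; concat)
open import Data.Nat.ListAction using (sum)
open import Data.List.Relation.Unary.All using (All)
open import Data.Product using (_×_; ∃-syntax)
open import Data.Sum using (_⊎_)
open import Relation.Binary.PropositionalEquality using (_≡_)

-- Strings are lists of natural numbers; symbol 𝚒 is the number i.

InS : ℕ → ℕ → List ℕ → Set
InS k n s = length s ≡ n × All (λ a → 1 ≤ a × a ≤ k) s

weight : List ℕ → ℕ
weight = sum

InSw : ℕ → ℕ → ℕ → List ℕ → Set
InSw k n w s = InS k n s × w ≤ weight s

data _<ₗ_ : List ℕ → List ℕ → Set where
  nil  : ∀ {y ys} → [] <ₗ (y ∷ ys)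
  here : ∀ {x y xs ys} → x < y → (x ∷ xs) <ₗ (y ∷ ys)
  there : ∀ {x xs ys} → xs <ₗ ys → (x ∷ xs) <ₗ (x ∷ ys)

_≤ₗ_ : List ℕ → List ℕ → Set
s ≤ₗ t = s <ₗ t ⊎ s ≡ t

rotate : ℕ → List ℕ → List ℕ
rotate i s = drop i s ++ take i s

IsNecklace : List ℕ → Set
IsNecklace s = ∀ i → i < length s → s ≤ₗ rotate i s

InN : ℕ → ℕ → List ℕ → Set
InN k n s = InS k n s × IsNecklace s

InNw : ℕ → ℕ → ℕ → List ℕ → Set
InNw k n w s = InSw k n w s × IsNecklace s

IsSuffix : List ℕ → List ℕ → Set
IsSuffix t s = ∃[ u ] s ≡ u ++ t

IsPrefix : List ℕ → List ℕ → Set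
IsPrefix t s = ∃[ u ] s ≡ t ++ u

pow : List ℕ → ℕ → List ℕ
pow t j = concat (replicate j t)

IsAp : List ℕ → List ℕ → Set
IsAp t s = (∃[ j ] (1 ≤ j × s ≡ pow t j))
         × (∀ t′ j′ → 1 ≤ j′ → s ≡ pow t′ j′ → length t ≤ length t′)

Consecutive : ℕ → ℕ → List ℕ → List ℕ → Set
Consecutive k n β₁ β₂ =
  InN k n β₁ × InN k n β₂ ×
  ( (β₁ <ₗ β₂ × (∀ γ → InN k n γ → β₁ <ₗ γ → γ <ₗ β₂ → γ ≡ β₁ ⊎ γ ≡ β₂))
  ⊎ ((∀ γ → InN k n γ → γ ≤ₗ β₁) × (∀ γ → InN k n γ → β₂ ≤ₗ γ)))

{-# OPTIONS --safe #-}
-- Write β₁ = u p and β₂ = q v. Maximality of q makes q nonempty, and |u| = |q|.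
-- Two operations keep a necklace a necklace: raising a symbol c to c′ > c when every later
-- symbol is ≥ c′, and replacing a proper suffix by k's.
-- If p is not all k, raising its last symbol below k gives a necklace u p′ > β₁. So β₁ is not
-- the last necklace, and β₂, lying between u p and u p′, starts with u; hence q = u and
-- δ₁ = β₁ = q p. If p is not a suffix of t, then p = m t, and (t q) m = δ₁ makes t q a longer
-- admissible suffix of s than q.
-- If p = kᵐ and β₁ is the last necklace, then β₂ = 1ⁿ, so q consists of 1's, α₁ starts with q,
-- and s = k^(n-|q|) a₁⋯a_|q| is excluded. Otherwise, replacing the last |p| symbols of δ₁ by
-- k's gives a necklace of weight ≥ w that is still ≤ β₁, so δ₁ already ends in p; and if p is
-- not a suffix of t, then t is a suffix of p = kᵐ, so δ₁ = kⁿ ≥ β₂ > β₁.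

module Submission where

open import Defs
open import Data.Nat using (ℕ; zero; suc; _+_; _*_; _∸_; _≤_; _<_; z≤n; s≤s; z<s)
open import Data.Nat.Properties
open import Data.Nat.ListAction using (sum)
open import Data.Nat.ListAction.Properties using (sum-++; sum-↭)
open import Data.List using (List; []; _∷_; _++_; _∷ʳ_; length; take; drop; replicate)
open import Data.List.Properties using (++-assoc; ++-identityʳ; ++-conicalʳ; length-++-comm; ∷-injective; ∷-injectiveˡ; ∷-injectiveʳ; ∷ʳ-++; length-++; length-++-≤ˡ; length-++-≤ʳ; length-replicate; length-take; length-drop; take++drop≡id)
open import Data.List.Relation.Unary.All as All using (All; []; _∷_; all?)
import Data.List.Relation.Unary.All.Properties as All
open import Data.List.Relation.Binary.Permutation.Propositional using (_↭_)
open import Data.List.Relation.Binary.Permutation.Propositional.Properties using (↭-length; All-resp-↭; ++-comm)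
open import Data.Product using (_×_; _,_; proj₁; proj₂; ∃-syntax; map₂; uncurry)
open import Data.Sum using (_⊎_; inj₁; inj₂; [_,_]′)
open import Function using (id)
open import Data.Empty using (⊥; ⊥-elim)
open import Relation.Binary using (tri<; tri≈; tri>)
open import Relation.Nullary using (¬_; yes; no)
open import Relation.Binary.PropositionalEquality using (_≡_; _≢_; refl; sym; trans; cong; cong₂; subst; subst₂)

private
  variable
    A : Set
    c c′ k n w x y : ℕ
    xs ys zs zs′ ws ws′ : List ℕ

<ₗ-irrefl : ¬ xs <ₗ xs
<ₗ-irrefl (here x<x)    = <-irrefl refl x<x
<ₗ-irrefl (there xs<xs) = <ₗ-irrefl xs<xs

<ₗ-trans : xs <ₗ ys → ys <ₗ zs → xs <ₗ zs
<ₗ-trans nil         (here _)    = nil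
<ₗ-trans nil         (there _)   = nil
<ₗ-trans (here x<y)  (here y<z)  = here (<-trans x<y y<z)
<ₗ-trans (here x<y)  (there _)   = here x<y
<ₗ-trans (there _)   (here y<z)  = here y<z
<ₗ-trans (there lt₁) (there lt₂) = there (<ₗ-trans lt₁ lt₂)

≤ₗ-<ₗ-trans : xs ≤ₗ ys → ys <ₗ zs → xs <ₗ zs
≤ₗ-<ₗ-trans (inj₁ xs<ys) ys<zs = <ₗ-trans xs<ys ys<zs
≤ₗ-<ₗ-trans (inj₂ refl)  ys<zs = ys<zs

<ₗ-≤ₗ-trans : xs <ₗ ys → ys ≤ₗ zs → xs <ₗ zs
<ₗ-≤ₗ-trans xs<ys (inj₁ ys<zs) = <ₗ-trans xs<ys ys<zs
<ₗ-≤ₗ-trans xs<ys (inj₂ refl)  = xs<ys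

≤ₗ-antisym : xs ≤ₗ ys → ys ≤ₗ xs → xs ≡ ys
≤ₗ-antisym (inj₂ xs≡ys)  _             = xs≡ys
≤ₗ-antisym (inj₁ _)      (inj₂ ys≡xs)  = sym ys≡xs
≤ₗ-antisym (inj₁ xs<ys)  (inj₁ ys<xs)  = ⊥-elim (<ₗ-irrefl (<ₗ-trans xs<ys ys<xs))

++-monoʳ-<ₗ : ∀ us → xs <ₗ ys → (us ++ xs) <ₗ (us ++ ys)
++-monoʳ-<ₗ []       xs<ys = xs<ys
++-monoʳ-<ₗ (_ ∷ us) xs<ys = there (++-monoʳ-<ₗ us xs<ys)

++-monoʳ-≤ₗ : ∀ us → xs ≤ₗ ys → (us ++ xs) ≤ₗ (us ++ ys)
++-monoʳ-≤ₗ us (inj₁ xs<ys) = inj₁ (++-monoʳ-<ₗ us xs<ys)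
++-monoʳ-≤ₗ us (inj₂ refl)  = inj₂ refl

≤ₗ⊎>ₗ : ∀ xs ys → xs ≤ₗ ys ⊎ ys <ₗ xs
≤ₗ⊎>ₗ []       []       = inj₁ (inj₂ refl)
≤ₗ⊎>ₗ []       (_ ∷ _)  = inj₁ (inj₁ nil)
≤ₗ⊎>ₗ (_ ∷ _)  []       = inj₂ nil
≤ₗ⊎>ₗ (x ∷ xs) (y ∷ ys) with <-cmp x y
... | tri< x<y _ _ = inj₁ (inj₁ (here x<y))
... | tri> _ _ y<x = inj₂ (here y<x)
... | tri≈ _ refl _ with ≤ₗ⊎>ₗ xs ys
...   | inj₁ xs≤ys = inj₁ (++-monoʳ-≤ₗ (x ∷ []) xs≤ys)
...   | inj₂ ys<xs = inj₂ (there ys<xs)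

≤ₗ-uncons : (x ∷ xs) ≤ₗ (y ∷ ys) → x < y ⊎ (x ≡ y × xs ≤ₗ ys)
≤ₗ-uncons (inj₁ (here x<y))     = inj₁ x<y
≤ₗ-uncons (inj₁ (there xs<ys))  = inj₂ (refl , inj₁ xs<ys)
≤ₗ-uncons (inj₂ refl)           = inj₂ (refl , inj₂ refl)

≤ₗ-head : (x ∷ xs) ≤ₗ (y ∷ ys) → x ≤ y
≤ₗ-head le with ≤ₗ-uncons le
... | inj₁ x<y        = <⇒≤ x<y
... | inj₂ (refl , _) = ≤-refl

<ₗ-++ : ∀ zs ws → length xs ≡ length ys → xs <ₗ ys → (xs ++ zs) <ₗ (ys ++ ws)
<ₗ-++ _ _ ()  nil
<ₗ-++ _ _ _   (here x<y)    = here x<y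
<ₗ-++ zs ws eq (there xs<ys) = there (<ₗ-++ zs ws (suc-injective eq) xs<ys)

≤ₗ-++⁻ : ∀ xs ys → length xs ≡ length ys → (xs ++ zs) ≤ₗ (ys ++ ws) → xs ≤ₗ ys
≤ₗ-++⁻ []       []       _  _  = inj₂ refl
≤ₗ-++⁻ (x ∷ xs) (y ∷ ys) eq le with ≤ₗ-uncons le
... | inj₁ x<y          = inj₁ (here x<y)
... | inj₂ (refl , le′) = ++-monoʳ-≤ₗ (x ∷ []) (≤ₗ-++⁻ xs ys (suc-injective eq) le′)

≤ₗ⇒<ₗ-raised : ∀ xs ys → length ys < length xs → c < c′ →
               (xs ++ zs) ≤ₗ (ys ++ c ∷ ws) → (xs ++ zs′) <ₗ (ys ++ c′ ∷ ws′)
≤ₗ⇒<ₗ-raised (_ ∷ _)  []       _         c<c′ le = here (≤-<-trans (≤ₗ-head le) c<c′)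
≤ₗ⇒<ₗ-raised (x ∷ xs) (y ∷ ys) (s≤s len) c<c′ le with ≤ₗ-uncons le
... | inj₁ x<y         = here x<y
... | inj₂ (refl , le′) = there (≤ₗ⇒<ₗ-raised xs ys len c<c′ le′)

≤ₗ-separated : length xs ≡ length ys → All (_≤ c) xs → All (c ≤_) ys → xs ≤ₗ ys
≤ₗ-separated _ [] [] = inj₂ refl
≤ₗ-separated {xs = x ∷ _} eq (x≤c ∷ xs≤c) (c≤y ∷ c≤ys) with m≤n⇒m<n∨m≡n (≤-trans x≤c c≤y)
... | inj₁ x<y  = inj₁ (here x<y)
... | inj₂ refl = ++-monoʳ-≤ₗ (x ∷ []) (≤ₗ-separated (suc-injective eq) xs≤c c≤ys)

sum-separated : length xs ≡ length ys → All (_≤ c) xs → All (c ≤_) ys → sum xs ≤ sum ys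
sum-separated _  []           []           = z≤n
sum-separated eq (x≤c ∷ xs≤c) (c≤y ∷ c≤ys) =
  +-mono-≤ (≤-trans x≤c c≤y) (sum-separated (suc-injective eq) xs≤c c≤ys)

common-prefix-between : ∀ us → (us ++ xs) <ₗ ys → ys ≤ₗ (us ++ zs) → ∃[ vs ] ys ≡ us ++ vs
common-prefix-between []       _           _                   = _ , refl
common-prefix-between (_ ∷ _)  _           (inj₂ ys≡)          = _ , ys≡
common-prefix-between (_ ∷ _)  (here u<y)  (inj₁ (here y<u))   = ⊥-elim (<-asym u<y y<u)
common-prefix-between (_ ∷ _)  (here u<u)  (inj₁ (there _))    = ⊥-elim (<-irrefl refl u<u)
common-prefix-between (_ ∷ _)  (there _)   (inj₁ (here u<u))   = ⊥-elim (<-irrefl refl u<u)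
common-prefix-between (u ∷ us) (there lt)  (inj₁ (there gt))   =
  map₂ (cong (u ∷_)) (common-prefix-between us lt (inj₁ gt))

++-equidivisible : ∀ (xs ys us vs : List A) → xs ++ ys ≡ us ++ vs →
                   (∃[ m ] (us ≡ xs ++ m × ys ≡ m ++ vs)) ⊎ (∃[ m ] (xs ≡ us ++ m × vs ≡ m ++ ys))
++-equidivisible []       ys us       vs eq = inj₁ (us , refl , eq)
++-equidivisible (x ∷ xs) ys []       vs eq = inj₂ (x ∷ xs , refl , sym eq)
++-equidivisible (x ∷ xs) ys (u ∷ us) vs eq with ∷-injective eq
... | refl , eq′ with ++-equidivisible xs ys us vs eq′
...   | inj₁ (m , us≡ , ys≡) = inj₁ (m , cong (x ∷_) us≡ , ys≡)
...   | inj₂ (m , xs≡ , vs≡) = inj₂ (m , cong (x ∷_) xs≡ , vs≡)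

++-injectiveˡ : ∀ (xs us : List A) {ys vs} → length xs ≡ length us → xs ++ ys ≡ us ++ vs → xs ≡ us
++-injectiveˡ []       []       _  _  = refl
++-injectiveˡ (x ∷ xs) (u ∷ us) eq e =
  cong₂ _∷_ (∷-injectiveˡ e) (++-injectiveˡ xs us (suc-injective eq) (∷-injectiveʳ e))

All-≡⇒replicate : ∀ {a : A} {xs} → All (_≡ a) xs → xs ≡ replicate (length xs) a
All-≡⇒replicate []             = refl
All-≡⇒replicate (refl ∷ xs≡a) = cong (_ ∷_) (All-≡⇒replicate xs≡a)

last-≢-split : ∀ ps → ¬ All (_≡ k) ps →
               ∃[ ps₀ ] ∃[ c ] ∃[ ks ] (ps ≡ ps₀ ++ c ∷ ks × c ≢ k × All (_≡ k) ks)
last-≢-split []       ¬all = ⊥-elim (¬all [])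
last-≢-split {k} (c ∷ ps) ¬all with all? (_≟ k) ps
... | yes ps≡k = [] , c , ps , refl , (λ c≡k → ¬all (c≡k ∷ ps≡k)) , ps≡k
... | no ¬all′ with last-≢-split ps ¬all′
...   | ps₀ , c′ , ks , refl , c′≢k , ks≡k = c ∷ ps₀ , c′ , ks , refl , c′≢k , ks≡k

pow-suc : ∀ t j → pow t (suc j) ≡ pow t j ++ t
pow-suc t zero    = ++-identityʳ t
pow-suc t (suc j) = trans (cong (t ++_) (pow-suc t j)) (sym (++-assoc t (pow t j) t))

pow-[] : ∀ j → pow [] j ≡ []
pow-[] zero    = refl
pow-[] (suc j) = pow-[] j

All-pow : ∀ {P : ℕ → Set} {t} j → All P t → All P (pow t j)
All-pow j Pt = All.concat⁺ (All.replicate⁺ j Pt)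

InSw-resp-↭ : xs ↭ ys → InSw k n w xs → InSw k n w ys
InSw-resp-↭ xs↭ys ((|xs|≡n , symbols) , w≤) =
  (trans (sym (↭-length xs↭ys)) |xs|≡n , All-resp-↭ xs↭ys symbols) , subst (_ ≤_) (sum-↭ xs↭ys) w≤

IsNecklace′ : List ℕ → Set
IsNecklace′ s = ∀ xs ys → s ≡ xs ++ ys → s ≤ₗ (ys ++ xs)

rotate-length-++ : ∀ xs ys → rotate (length xs) (xs ++ ys) ≡ ys ++ xs
rotate-length-++ xs ys = cong₂ _++_ (drop-length-++ xs) (take-length-++ xs)
  where
  drop-length-++ : ∀ xs → drop (length xs) (xs ++ ys) ≡ ys
  drop-length-++ []       = refl
  drop-length-++ (_ ∷ xs) = drop-length-++ xs
  take-length-++ : ∀ xs → take (length xs) (xs ++ ys) ≡ xs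
  take-length-++ []       = refl
  take-length-++ (x ∷ xs) = cong (x ∷_) (take-length-++ xs)

IsNecklace⇒IsNecklace′ : ∀ {s} → IsNecklace s → IsNecklace′ s
IsNecklace⇒IsNecklace′ N xs []       refl = inj₂ (++-identityʳ xs)
IsNecklace⇒IsNecklace′ N xs (y ∷ ys) refl =
  subst ((xs ++ y ∷ ys) ≤ₗ_) (rotate-length-++ xs (y ∷ ys))
    (N (length xs) (subst (length xs <_) (sym (length-++ xs)) (m<m+n (length xs) z<s)))

IsNecklace′⇒IsNecklace : ∀ {s} → IsNecklace′ s → IsNecklace s
IsNecklace′⇒IsNecklace {s} N i _ = N (take i s) (drop i s) (sym (take++drop≡id i s))

replicate-isNecklace : ∀ n c → IsNecklace (replicate n c)
replicate-isNecklace n c = IsNecklace′⇒IsNecklace rotation-≥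
  where
  rotation-≥ : IsNecklace′ (replicate n c)
  rotation-≥ xs ys eq = ≤ₗ-separated (trans (cong length eq) (↭-length (++-comm xs ys)))
    (All.replicate⁺ n ≤-refl)
    (All.map (λ x≡c → ≤-reflexive (sym x≡c))
      (All-resp-↭ (++-comm xs ys) (subst (All (_≡ c)) eq (All.replicate⁺ n refl))))

-- A rotation starting at or before the raised symbol agreed with the string up to that symbol
-- and now loses there strictly; a later rotation starts with a symbol ≥ c′ > c ≥ x₀.
IsNecklace′-raise-symbol : ∀ {x₀} xs {K} → c < c′ → All (c′ ≤_) K →
                           IsNecklace′ (x₀ ∷ xs ++ c ∷ K) → IsNecklace′ (x₀ ∷ xs ++ c′ ∷ K)
IsNecklace′-raise-symbol _ _ _ N [] ys eq = inj₂ (trans eq (sym (++-identityʳ ys)))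
IsNecklace′-raise-symbol {c} {c′} {x₀} xs {K} c<c′ c′≤K N (a₀ ∷ a) ys eq
  with ++-equidivisible (a₀ ∷ a) ys (x₀ ∷ xs) (c′ ∷ K) (sym eq)
... | inj₁ (m , refl , refl) =
  inj₁ (subst (((a₀ ∷ a ++ m) ++ c′ ∷ K) <ₗ_) (sym (++-assoc m (c′ ∷ K) (a₀ ∷ a)))
         (≤ₗ⇒<ₗ-raised {ws′ = K ++ a₀ ∷ a} (a₀ ∷ a ++ m) m (s≤s (length-++-≤ʳ m {a})) c<c′ old))
  where
  old : ((a₀ ∷ a ++ m) ++ c ∷ K) ≤ₗ (m ++ c ∷ K ++ a₀ ∷ a)
  old = subst (((a₀ ∷ a ++ m) ++ c ∷ K) ≤ₗ_) (++-assoc m (c ∷ K) (a₀ ∷ a))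
          (N (a₀ ∷ a) (m ++ c ∷ K) (cong (a₀ ∷_) (++-assoc a m (c ∷ K))))
IsNecklace′-raise-symbol _ _ _ _ (_ ∷ _) [] eq | inj₂ _ = inj₂ (trans eq (++-identityʳ _))
IsNecklace′-raise-symbol {c} {c′} {x₀} xs {K} c<c′ c′≤K N (_ ∷ _) (y ∷ _) _
  | inj₂ (m , _ , c′K≡m++y∷ys) =
  inj₁ (here (<-≤-trans (≤-<-trans x₀≤c c<c′) c′≤y))
  where
  x₀≤c : x₀ ≤ c
  x₀≤c = ≤ₗ-head (N (x₀ ∷ xs) (c ∷ K) refl)
  c′≤y : c′ ≤ y
  c′≤y = All.head (All.++⁻ʳ m (subst (All (c′ ≤_)) c′K≡m++y∷ys (≤-refl ∷ c′≤K)))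

IsNecklace′-raise-suffix : ∀ {x₀} xs zs → All (_≤ k) zs →
                           IsNecklace′ (x₀ ∷ xs ++ zs) →
                           IsNecklace′ (x₀ ∷ xs ++ replicate (length zs) k)
IsNecklace′-raise-suffix xs []       _            N = N
IsNecklace′-raise-suffix {k} {x₀} xs (z ∷ zs) (z≤k ∷ zs≤k) N = raise-head (m≤n⇒m<n∨m≡n z≤k)
  where
  N′ : IsNecklace′ (x₀ ∷ xs ++ z ∷ replicate (length zs) k)
  N′ = subst (λ ys → IsNecklace′ (x₀ ∷ ys)) (∷ʳ-++ xs z _)
         (IsNecklace′-raise-suffix (xs ∷ʳ z) zs zs≤k
           (subst (λ ys → IsNecklace′ (x₀ ∷ ys)) (sym (∷ʳ-++ xs z zs)) N))
  raise-head : z < k ⊎ z ≡ k → IsNecklace′ (x₀ ∷ xs ++ k ∷ replicate (length zs) k)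
  raise-head (inj₁ z<k) = IsNecklace′-raise-symbol xs z<k (All.replicate⁺ _ ≤-refl) N′
  raise-head (inj₂ z≡k) = subst (λ a → IsNecklace′ (x₀ ∷ xs ++ a ∷ _)) z≡k N′

InN-raise-symbol : ∀ {x₀} xs {K} → c < c′ → c′ ≤ k → All (c′ ≤_) K →
                   InN k n (x₀ ∷ xs ++ c ∷ K) → InN k n (x₀ ∷ xs ++ c′ ∷ K)
InN-raise-symbol {x₀ = x₀} xs c<c′ c′≤k c′≤K ((|s|≡n , symbols) , N) =
  ( trans (length-++ (x₀ ∷ xs)) (trans (sym (length-++ (x₀ ∷ xs))) |s|≡n)
  , All.++⁺ (All.++⁻ˡ (x₀ ∷ xs) symbols)
            ((≤-trans (s≤s z≤n) c<c′ , c′≤k) ∷ All.tail (All.++⁻ʳ (x₀ ∷ xs) symbols)))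
  , IsNecklace′⇒IsNecklace (IsNecklace′-raise-symbol xs c<c′ c′≤K (IsNecklace⇒IsNecklace′ N))

larger-necklace-with-prefix : ∀ us {ps} → 0 < length us → ¬ All (_≡ k) ps → InN k n (us ++ ps) →
                              ∃[ ps′ ] (InN k n (us ++ ps′) × (us ++ ps) <ₗ (us ++ ps′))
larger-necklace-with-prefix {k} {n} (u₀ ∷ us) {ps} _ ps≢k us++ps∈N with last-≢-split ps ps≢k
... | ps₀ , c , ks , refl , c≢k , ks≡k =
  ps₀ ++ suc c ∷ ks
  , subst (InN k n) (reassoc (suc c))
      (InN-raise-symbol (us ++ ps₀) (n<1+n c) c<k (All.map (λ { refl → c<k }) ks≡k)
        (subst (InN k n) (sym (reassoc c)) us++ps∈N))
  , ++-monoʳ-<ₗ (u₀ ∷ us) (++-monoʳ-<ₗ ps₀ (here (n<1+n c)))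
  where
  reassoc : ∀ a → u₀ ∷ (us ++ ps₀) ++ a ∷ ks ≡ u₀ ∷ us ++ ps₀ ++ a ∷ ks
  reassoc a = cong (u₀ ∷_) (++-assoc us ps₀ (a ∷ ks))
  c<k : c < k
  c<k = ≤∧≢⇒< (proj₂ (All.head (All.++⁻ʳ ps₀ (All.++⁻ʳ (u₀ ∷ us) (proj₂ (proj₁ us++ps∈N)))))) c≢k

next-necklace-shares-prefix : ∀ us {ps β} → 0 < length us → ¬ All (_≡ k) ps → InN k n (us ++ ps) →
  (us ++ ps) <ₗ β → (∀ γ → InN k n γ → (us ++ ps) <ₗ γ → γ <ₗ β → γ ≡ us ++ ps ⊎ γ ≡ β) →
  ∃[ vs ] β ≡ us ++ vs
next-necklace-shares-prefix us {β = β} 0<|us| ps≢k us++ps∈N us++ps<β between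
  with larger-necklace-with-prefix us 0<|us| ps≢k us++ps∈N
... | ps′ , us++ps′∈N , us++ps<us++ps′ with ≤ₗ⊎>ₗ β (us ++ ps′)
...   | inj₁ β≤us++ps′ = common-prefix-between us us++ps<β β≤us++ps′
...   | inj₂ us++ps′<β with between _ us++ps′∈N us++ps<us++ps′ us++ps′<β
...     | inj₁ eq = ⊥-elim (<ₗ-irrefl (subst (_ <ₗ_) eq us++ps<us++ps′))
...     | inj₂ eq = ⊥-elim (<ₗ-irrefl (subst (_<ₗ β) eq us++ps′<β))

least-necklace≡1ⁿ : ∀ {β} → 1 ≤ k → InN k n β → (∀ γ → InN k n γ → β ≤ₗ γ) → β ≡ replicate n 1
least-necklace≡1ⁿ {n = n} 1≤k ((|β|≡n , symbols) , _) β-min =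
  ≤ₗ-antisym
    (β-min (replicate n 1)
      ((length-replicate n , All.replicate⁺ n (≤-refl , 1≤k)) , replicate-isNecklace n 1))
    (≤ₗ-separated (trans (length-replicate n) (sym |β|≡n))
      (All.replicate⁺ n ≤-refl) (All.map proj₁ symbols))

take-≡-of-minimal-symbols : ∀ α xs → All (_≤ c) xs → All (c ≤_) α → length xs ≤ length α →
                            α ≤ₗ (xs ++ ys) → take (length xs) α ≡ xs
take-≡-of-minimal-symbols {ys = ys} α xs xs≤c c≤α |xs|≤|α| α≤xs++ys =
  ≤ₗ-antisym
    (≤ₗ-++⁻ (take (length xs) α) xs |take|≡|xs|
      (subst (_≤ₗ (xs ++ ys)) (sym (take++drop≡id (length xs) α)) α≤xs++ys))
    (≤ₗ-separated (sym |take|≡|xs|) xs≤c (All.take⁺ (length xs) c≤α))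
  where
  |take|≡|xs| : length (take (length xs) α) ≡ length xs
  |take|≡|xs| = trans (length-take (length xs) α) (m≤n⇒m⊓n≡m |xs|≤|α|)

InNw-raise-suffix : ∀ ys zs → 0 < length ys → 1 ≤ k →
                    InNw k n w (ys ++ zs) → InNw k n w (ys ++ replicate (length zs) k)
InNw-raise-suffix {k} (y₀ ∷ ys) zs _ 1≤k (((|s|≡n , symbols) , w≤) , N) =
  ( ( trans (length-++ (y₀ ∷ ys)) (trans (cong (length (y₀ ∷ ys) +_) (length-replicate (length zs)))
      (trans (sym (length-++ (y₀ ∷ ys))) |s|≡n))
    , All.++⁺ (All.++⁻ˡ (y₀ ∷ ys) symbols) (All.replicate⁺ _ (1≤k , ≤-refl)))
  , ≤-trans w≤ (subst₂ _≤_ (sym (sum-++ (y₀ ∷ ys) zs)) (sym (sum-++ (y₀ ∷ ys) _))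
      (+-monoʳ-≤ (sum (y₀ ∷ ys))
        (sum-separated (sym (length-replicate (length zs))) zs≤k
          (All.replicate⁺ (length zs) ≤-refl)))))
  , IsNecklace′⇒IsNecklace (IsNecklace′-raise-suffix ys zs zs≤k (IsNecklace⇒IsNecklace′ N))
  where
  zs≤k : All (_≤ k) zs
  zs≤k = All.map proj₂ (All.++⁻ʳ (y₀ ∷ ys) symbols)

greatest-below-keeps-k-suffix : ∀ us ps {δ} → 1 ≤ k → 0 < length us → All (_≡ k) ps →
  length (us ++ ps) ≡ n → InNw k n w δ → δ ≤ₗ (us ++ ps) →
  (∀ γ → InNw k n w γ → γ ≤ₗ (us ++ ps) → γ ≤ₗ δ) →
  ∃[ ys ] δ ≡ ys ++ ps
greatest-below-keeps-k-suffix {k} {n} {w} us ps {δ} 1≤k 0<|us| ps≡k |us++ps|≡n δ∈Nw δ≤us++ps δ-max =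
  δˡ , ≤ₗ-antisym δ≤δˡ++ps (δ-max (δˡ ++ ps) δˡ++ps∈Nw δˡ++ps≤us++ps)
  where
  δˡ δʳ : List ℕ
  δˡ = take (length us) δ
  δʳ = drop (length us) δ
  δ≡δˡ++δʳ : δ ≡ δˡ ++ δʳ
  δ≡δˡ++δʳ = sym (take++drop≡id (length us) δ)
  |δ|≡|us++ps| : length δ ≡ length (us ++ ps)
  |δ|≡|us++ps| = trans (proj₁ (proj₁ (proj₁ δ∈Nw))) (sym |us++ps|≡n)
  |δˡ|≡|us| : length δˡ ≡ length us
  |δˡ|≡|us| = trans (length-take (length us) δ)
    (m≤n⇒m⊓n≡m (subst (length us ≤_) (sym |δ|≡|us++ps|) (length-++-≤ˡ us)))
  |δʳ|≡|ps| : length δʳ ≡ length ps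
  |δʳ|≡|ps| = trans (length-drop (length us) δ)
    (trans (cong (_∸ length us) (trans |δ|≡|us++ps| (length-++ us)))
      (m+n∸m≡n (length us) (length ps)))
  ps≡kᵐ : ps ≡ replicate (length δʳ) k
  ps≡kᵐ = trans (All-≡⇒replicate ps≡k) (cong (λ m → replicate m k) (sym |δʳ|≡|ps|))
  δˡ++ps∈Nw : InNw k n w (δˡ ++ ps)
  δˡ++ps∈Nw = subst (λ qs → InNw k n w (δˡ ++ qs)) (sym ps≡kᵐ)
    (InNw-raise-suffix δˡ δʳ (subst (0 <_) (sym |δˡ|≡|us|) 0<|us|) 1≤k
      (subst (InNw k n w) δ≡δˡ++δʳ δ∈Nw))
  δˡ++ps≤us++ps : (δˡ ++ ps) ≤ₗ (us ++ ps)
  δˡ++ps≤us++ps with ≤ₗ-++⁻ δˡ us |δˡ|≡|us| (subst (_≤ₗ (us ++ ps)) δ≡δˡ++δʳ δ≤us++ps)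
  ... | inj₁ δˡ<us  = inj₁ (<ₗ-++ ps ps |δˡ|≡|us| δˡ<us)
  ... | inj₂ δˡ≡us = inj₂ (cong (_++ ps) δˡ≡us)
  δ≤δˡ++ps : δ ≤ₗ (δˡ ++ ps)
  δ≤δˡ++ps = subst (_≤ₗ (δˡ ++ ps)) (sym δ≡δˡ++δʳ)
    (++-monoʳ-≤ₗ δˡ (≤ₗ-separated |δʳ|≡|ps|
      (All.map proj₂ (All.++⁻ʳ δˡ (subst (All _) δ≡δˡ++δʳ (proj₂ (proj₁ (proj₁ δ∈Nw))))))
      (All.map ≤-reflexive (All.map sym ps≡k))))

wrap-around-form : ∀ {α} p q v → All (_≡ k) p → q ++ v ≡ replicate n 1 → length (p ++ q) ≡ n →
  InNw k n w α → (∀ γ → InNw k n w γ → α ≤ₗ γ) → InNw k n w (q ++ p) →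
  p ++ q ≡ replicate (n ∸ length q) k ++ take (length q) α
wrap-around-form {k} {n} {α = α} p q v p≡k qv≡1ⁿ |pq|≡n (((|α|≡n , α-symbols) , _) , _)
                 α-min qp∈Nw =
  cong₂ _++_ p≡kᵐ (sym take≡q)
  where
  q≡1 : All (_≡ 1) q
  q≡1 = All.++⁻ˡ q (subst (All (_≡ 1)) (sym qv≡1ⁿ) (All.replicate⁺ n refl))
  take≡q : take (length q) α ≡ q
  take≡q = take-≡-of-minimal-symbols α q (All.map ≤-reflexive q≡1) (All.map proj₁ α-symbols)
    (subst (length q ≤_) (trans |pq|≡n (sym |α|≡n)) (length-++-≤ʳ q {p})) (α-min _ qp∈Nw)
  n∸|q|≡|p| : n ∸ length q ≡ length p
  n∸|q|≡|p| = trans (cong (_∸ length q) (trans (sym |pq|≡n) (length-++ p)))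
                    (m+n∸n≡m (length p) (length q))
  p≡kᵐ : p ≡ replicate (n ∸ length q) k
  p≡kᵐ = trans (All-≡⇒replicate p≡k) (cong (λ m → replicate m k) (sym n∸|q|≡|p|))

longest-rotation-suffix-nonempty : ∀ p₀ p q → IsNecklace (q ++ p₀ ∷ p) →
  (∀ p′ q′ → p₀ ∷ p ++ q ≡ p′ ++ q′ → IsNecklace (q′ ++ p′) → length q′ ≤ length q) → 0 < length q
longest-rotation-suffix-nonempty _  _ (_ ∷ _) _ _ = z<s
longest-rotation-suffix-nonempty p₀ p [] N longest
  with longest [] (p₀ ∷ p) (cong (p₀ ∷_) (++-identityʳ p))
                (subst IsNecklace (sym (++-identityʳ (p₀ ∷ p))) N)
... | ()

suffix-of-root-of-longest-rotation : ∀ p q {t j} → 1 ≤ j →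
  (∀ p′ q′ → p ++ q ≡ p′ ++ q′ → IsNecklace (q′ ++ p′) → length q′ ≤ length q) →
  IsNecklace (q ++ p) → q ++ p ≡ pow t j → IsSuffix p t
suffix-of-root-of-longest-rotation p q {[]} {j} _ _ _ qp≡tʲ =
  [] , sym (++-conicalʳ q p (trans qp≡tʲ (pow-[] j)))
suffix-of-root-of-longest-rotation p q {t@(_ ∷ _)} {suc j} _ longest N qp≡tʲ
  with ++-equidivisible q p (pow t j) t (trans qp≡tʲ (pow-suc t j))
... | inj₂ (m , _ , t≡m++p) = m , t≡m++p
... | inj₁ (m , tʲ≡q++m , p≡m++t) =
  ⊥-elim (<⇒≱ |q|<|tq| (longest m (t ++ q) pq≡m++tq (subst IsNecklace qp≡tq++m N)))
  where
  |q|<|tq| : length q < length (t ++ q)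
  |q|<|tq| = subst (length q <_) (sym (length-++ t)) (m<n+m (length q) z<s)
  pq≡m++tq : p ++ q ≡ m ++ t ++ q
  pq≡m++tq = trans (cong (_++ q) p≡m++t) (++-assoc m t q)
  qp≡tq++m : q ++ p ≡ (t ++ q) ++ m
  qp≡tq++m = trans qp≡tʲ (trans (cong (t ++_) tʲ≡q++m) (sym (++-assoc t q m)))

suffix-of-root-or-constant : ∀ ys p {t j} → All (_≡ k) p → 1 ≤ j → ys ++ p ≡ pow t j →
                             IsSuffix p t ⊎ All (_≡ k) (pow t j)
suffix-of-root-or-constant ys p {t} {suc j} p≡k _ ys++p≡tʲ
  with ++-equidivisible ys p (pow t j) t (trans ys++p≡tʲ (pow-suc t j))
... | inj₂ (m , _ , t≡m++p) = inj₁ (m , t≡m++p)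
... | inj₁ (m , _ , p≡m++t) = inj₂ (All-pow (suc j) (All.++⁻ʳ m (subst (All _) p≡m++t p≡k)))

lemma1 : (n k w : ℕ) → k < w → w < k * n →
    (α₁ : List ℕ) → InNw k n w α₁ → (∀ γ → InNw k n w γ → α₁ ≤ₗ γ) →
    (s : List ℕ) → InSw k n w s →
    (∀ j → j < n → ¬ (s ≡ replicate (n ∸ j) k ++ take j α₁)) →
    (p q : List ℕ) → s ≡ p ++ q → IsNecklace (q ++ p) →
    (∀ p′ q′ → s ≡ p′ ++ q′ → IsNecklace (q′ ++ p′) → length q′ ≤ length q) →
    (β₁ β₂ : List ℕ) → Consecutive k n β₁ β₂ → IsSuffix p β₁ → IsPrefix q β₂ →
    (δ₁ : List ℕ) → InNw k n w δ₁ → δ₁ ≤ₗ β₁ →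
    (∀ γ → InNw k n w γ → γ ≤ₗ β₁ → γ ≤ₗ δ₁) →
    (t : List ℕ) → IsAp t δ₁ → IsSuffix p t
lemma1 _ _ _ _ _ _ _ _ _ _ _ [] _ _ _ _ _ _ _ _ _ _ _ _ _ t _ = t , sym (++-identityʳ t)
lemma1 n k w _ _ α₁ α₁∈Nw α₁-min _ pq∈Sw s-excluded p@(p₀ ∷ p′) q refl qp-necklace q-longest
       _ _ (β₁∈N , β₂∈N , adjacency) (u , refl) (v , refl) _ δ₁∈Nw δ₁≤β₁ δ₁-max
       t ((j , 1≤j , refl) , _) =
  [ uncurry adjacent , (λ (β₁-max , β₂-min) → ⊥-elim (wrap-around β₁-max β₂-min)) ]′ adjacency
  where
  |pq|≡n : length (p ++ q) ≡ n
  |pq|≡n = proj₁ (proj₁ pq∈Sw)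
  qp∈Nw : InNw k n w (q ++ p)
  qp∈Nw = InSw-resp-↭ (++-comm p q) pq∈Sw , qp-necklace
  1≤k : 1 ≤ k
  1≤k = let 1≤p₀ , p₀≤k = All.head (proj₂ (proj₁ pq∈Sw)) in ≤-trans 1≤p₀ p₀≤k
  |u|≡|q| : length u ≡ length q
  |u|≡|q| = +-cancelʳ-≡ (length p) (length u) (length q)
    (trans (sym (length-++ u)) (trans (proj₁ (proj₁ β₁∈N))
      (trans (sym |pq|≡n) (trans (length-++-comm p q) (length-++ q)))))
  0<|u| : 0 < length u
  0<|u| = subst (0 <_) (sym |u|≡|q|)
                 (longest-rotation-suffix-nonempty p₀ p′ q qp-necklace q-longest)

  wrap-around : (∀ γ → InN k n γ → γ ≤ₗ (u ++ p)) → (∀ γ → InN k n γ → (q ++ v) ≤ₗ γ) → ⊥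
  wrap-around β₁-max β₂-min with all? (_≟ k) p
  ... | no p≢k =
    let _ , up′∈N , up<up′ = larger-necklace-with-prefix u 0<|u| p≢k β₁∈N
    in <ₗ-irrefl (<ₗ-≤ₗ-trans up<up′ (β₁-max _ up′∈N))
  ... | yes p≡k = s-excluded (length q) |q|<n
    (wrap-around-form p q v p≡k (least-necklace≡1ⁿ 1≤k β₂∈N β₂-min) |pq|≡n α₁∈Nw α₁-min qp∈Nw)
    where
    |q|<n : length q < n
    |q|<n = subst (length q <_) (trans (sym (length-++ p)) |pq|≡n) (m<n+m (length q) z<s)

  adjacent : (u ++ p) <ₗ (q ++ v) →
    (∀ γ → InN k n γ → (u ++ p) <ₗ γ → γ <ₗ (q ++ v) → γ ≡ u ++ p ⊎ γ ≡ q ++ v) → IsSuffix p t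
  adjacent β₁<β₂ between with all? (_≟ k) p
  ... | no p≢k =
    let _ , qv≡ub = next-necklace-shares-prefix u 0<|u| p≢k β₁∈N β₁<β₂ between
        q≡u = ++-injectiveˡ q u (sym |u|≡|q|) qv≡ub
    in suffix-of-root-of-longest-rotation p q 1≤j q-longest qp-necklace
         (≤ₗ-antisym (δ₁-max _ qp∈Nw (inj₂ (cong (_++ p) q≡u)))
                     (subst (λ x → pow t j ≤ₗ (x ++ p)) (sym q≡u) δ₁≤β₁))
  ... | yes p≡k =
    let ys , δ₁≡ys++p = greatest-below-keeps-k-suffix u p 1≤k 0<|u| p≡k (proj₁ (proj₁ β₁∈N))
                          δ₁∈Nw δ₁≤β₁ δ₁-max
    in [ id , (λ δ₁≡k → ⊥-elim (<ₗ-irrefl (≤ₗ-<ₗ-trans (β₂≤δ₁ δ₁≡k) (≤ₗ-<ₗ-trans δ₁≤β₁ β₁<β₂)))) ]′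
         (suffix-of-root-or-constant ys p p≡k 1≤j (sym δ₁≡ys++p))
    where
    β₂≤δ₁ : All (_≡ k) (pow t j) → (q ++ v) ≤ₗ pow t j
    β₂≤δ₁ δ₁≡k = ≤ₗ-separated (trans (proj₁ (proj₁ β₂∈N)) (sym (proj₁ (proj₁ (proj₁ δ₁∈Nw)))))
      (All.map proj₂ (proj₂ (proj₁ β₂∈N))) (All.map (λ x≡k → ≤-reflexive (sym x≡k)) δ₁≡k)
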